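{- Let $p>1$ be an integer and let $b,B\in p\uparrow$ with $b\le B$. Let $n_1,\dots,n_k\in\mathbb{N}$ with $n_1<\dots<n_k$. Suppose $C\in\mathbb{Z}^+$ satisfies $b\le C/B^{n_k}\le B$. Let $M=\sum_{j=0}^{n_k}m_jB^j$, where $m_j=B-b$ if $j\in\{n_s: s=1,\dots,k\}$ and $m_j=B-1$ otherwise. Then for every integer $c$, $$c=\sum_{i=1}^k z_iB^{n_i}\text{ for some } z_1,\dots,z_k\in[0,b)\iff c\in[0,C)\ \wedge\ \tau_p(c,M)=0.$$
   Context: For a positive integer $q$, $q\uparrow:=\{q^n: n\in\mathbb{N}\}$. For integers $c,d$, $[c,d):=\{m\in\mathbb{Z}: c\le m<d\}$. For an integer $p>1$ and $a,b\in\mathbb{N}$, $\tau_p(a,b)$ denotes the number of carries occurring in the addition of $a$ and $b$ in base $p$. -}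

module Defs where

open import Data.Nat using (ℕ; zero; suc; _+_; _*_; _∸_; _^_; _≤ᵇ_; NonZero)
open import Data.Nat.DivMod using (_/_; _%_)
open import Data.Nat.Properties using (_≟_)
open import Data.Bool using (if_then_else_)
open import Data.Fin using (Fin)
open import Data.Fin.Properties using (any?)
open import Data.Product using (∃)
open import Data.List using (List; upTo)
open import Data.Nat.ListAction using (sum)
import Data.List as List
open import Relation.Binary.PropositionalEquality using (_≡_)
open import Relation.Nullary.Decidable using (⌊_⌋)

_∈↑_ : ℕ → ℕ → Set
x ∈↑ q = ∃ λ n → x ≡ q ^ n

carriesFrom : ℕ → (p : ℕ) → .{{NonZero p}} → ℕ → ℕ → ℕ → ℕ
carriesFrom zero    p a b cin = 0
carriesFrom (suc f) p a b cin =
  let s    = a % p + b % p + cin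
      cout = if p ≤ᵇ s then 1 else 0
  in cout + carriesFrom f p (a / p) (b / p) cout

-- τ_p(a,b): number of carries in the base-p addition of a and b.
-- a + b + 1 digit positions always suffice (afterwards no further carries occur).
τ : (p : ℕ) → .{{NonZero p}} → ℕ → ℕ → ℕ
τ p a b = carriesFrom (a + b + 1) p a b 0

ΣFin : (k : ℕ) → (Fin k → ℕ) → ℕ
ΣFin k f = sum (List.tabulate f)

digitM : ∀ {k} → (B b : ℕ) → (Fin k → ℕ) → ℕ → ℕ
digitM {k} B b n j = if ⌊ any? (λ s → n s ≟ j) ⌋ then B ∸ b else B ∸ 1

Mnum : ∀ {k} → (B b : ℕ) → (Fin k → ℕ) → (N : ℕ) → ℕ
Mnum B b n N = sum (List.map (λ j → digitM B b n j * B ^ j) (upTo (suc N)))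

-- As B is a power of p, a base-B digit is a block of β base-p digits,
-- and an addition without carries is one that is carry-free block by block
-- (noCarry-split).  The digit B − p^γ consists of γ zero digits followed by
-- digits p − 1, so a block x < B adds to it without carry iff x < p^γ
-- (noCarry-block).  Hence c < B^{N+1} adds to M without carry iff its base-B
-- digits are below b at the positions n_i and zero elsewhere
-- (noCarry-digits⇒/⇐), i.e. iff c = Σ_i z_i B^{n_i} with z_i < b.  Such sums
-- lie below b·B^N ≤ C, while C ≤ B^{N+1} makes c < C enough for the converse.
module Submission where

open import Defs
open import Data.Nat using (ℕ; suc; _+_; _*_; _^_; _<_; _≤_; NonZero)
open import Data.Integer using (ℤ; +_; ∣_∣)
import Data.Integer as ℤ
open import Data.Fin using (Fin; fromℕ)
import Data.Fin as Fin
open import Data.Product using (_×_; Σ)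
open import Function.Bundles using (_⇔_)
open import Relation.Binary.PropositionalEquality using (_≡_)

open import Data.Nat
open import Data.Nat.Properties
open import Data.Nat.DivMod
open import Data.Nat.Divisibility using (m∣m*n)
import Data.Nat.ListAction as List
open import Data.Integer using (-[1+_])
open import Data.Fin using (zero; suc; punchIn)
open import Data.Fin.Properties using (any?; punchInᵢ≢i; ≤fromℕ; toℕ-fromℕ; toℕ-injective)
import Data.Fin.Properties as Finₚ
open import Data.List using (applyUpTo)
open import Data.List.Properties using (map-upTo)
open import Data.Bool using (true; false; T; if_then_else_)
open import Data.Unit using (tt)
open import Data.Empty using (⊥-elim)
open import Data.Sum using (inj₁; inj₂)
open import Data.Product using (_,_; proj₁; proj₂)
open import Data.Product.Algebra using (×-assoc)
open import Data.Product.Function.NonDependent.Propositional using (_×-⇔_)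
open import Function.Base using (_∘_)
open import Function.Bundles using (mk⇔; Equivalence)
open import Function.Definitions using (Injective)
import Function.Properties.Equivalence as ⇔
open import Function.Related.Propositional as Related using ()
open import Relation.Binary.Definitions using (tri<; tri≈; tri>)
open import Relation.Binary.PropositionalEquality
open import Relation.Nullary using (yes; no)
open import Relation.Nullary.Decidable using (⌊_⌋)
open import Algebra.Properties.CommutativeSemigroup *-commutativeSemigroup using (x∙yz≈y∙xz)
open import Algebra.Properties.Semiring.Sum +-*-semiring
  using (sum; sum-syntax; ∑-distrib-+; *-distribˡ-sum; sum-remove; sum-cong-≗; sum-replicate-zero)

module NoCarries (p : ℕ) .{{_ : NonZero p}} (1<p : 1 < p) where

  open Equivalence using (to; from)
  open Related.EquationalReasoning

  DigitsFit : ℕ → ℕ → Set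
  DigitsFit a m = a % p + m % p < p

  NoCarry : ℕ → ℕ → Set
  NoCarry a m = ∀ f → carriesFrom f p a m 0 ≡ 0

  carry-step : ∀ f a m →
    carriesFrom (suc f) p a m 0 ≡ 0 ⇔ (DigitsFit a m × carriesFrom f p (a / p) (m / p) 0 ≡ 0)
  carry-step f a m with p ≤ᵇ (a % p + m % p + 0) in overflow
  ... | true  = mk⇔ (λ ()) (λ (fits , _) → ⊥-elim (<⇒≱ (subst (_< p) (sym (+-identityʳ _)) fits) overflows))
    where
    overflows : p ≤ a % p + m % p + 0
    overflows = ≤ᵇ⇒≤ p _ (subst T (sym overflow) tt)
  ... | false = mk⇔ (λ rest → fits , rest) proj₂
    where
    fits : DigitsFit a m
    fits = subst (_< p) (+-identityʳ _) (≰⇒> (λ overflows → subst T overflow (≤⇒≤ᵇ overflows)))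

  noCarry-step : ∀ {a m} → NoCarry a m ⇔ (DigitsFit a m × NoCarry (a / p) (m / p))
  noCarry-step {a} {m} = mk⇔
    (λ none → proj₁ (to (carry-step 0 a m) (none 1)) , λ f → proj₂ (to (carry-step f a m) (none (suc f))))
    λ { (_    , _   ) zero    → refl
      ; (fits , none) (suc f) → from (carry-step f a m) (fits , none f) }

  0%p : 0 % p ≡ 0
  0%p = m<n⇒m%n≡m (>-nonZero⁻¹ p)

  0/p : 0 / p ≡ 0
  0/p = 0/n≡0 p

  noCarry-zeroʳ : ∀ a → NoCarry a 0
  noCarry-zeroʳ a zero    = refl
  noCarry-zeroʳ a (suc f) = from (carry-step f a 0) (fits ,
    subst (λ z → carriesFrom f p (a / p) z 0 ≡ 0) (sym 0/p) (noCarry-zeroʳ (a / p) f))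
    where
    fits : DigitsFit a 0
    fits = subst (λ r → a % p + r < p) (sym 0%p) (subst (_< p) (sym (+-identityʳ _)) (m%n<n a p))

  -- Dividing both summands by p strictly decreases a positive sum, so
  -- a + m digit positions always exhaust the digits of a and m.
  halving : ∀ a m f → a + m ≤ suc f → a / p + m / p ≤ f
  halving zero    zero    f _ rewrite 0/p = z≤n
  halving zero    (suc m) f a+m≤ rewrite 0/p = s≤s⁻¹ (≤-trans (m/n<m (suc m) p 1<p) a+m≤)
  halving (suc a) m       f a+m≤ = s≤s⁻¹ (≤-trans (+-mono-<-≤ (m/n<m (suc a) p 1<p) (m/n≤m m p)) a+m≤)

  fuel-suffices : ∀ f a m → a + m ≤ f → carriesFrom f p a m 0 ≡ 0 → NoCarry a m
  fuel-suffices zero    zero    zero    _    _    = noCarry-zeroʳ 0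
  fuel-suffices zero    zero    (suc m) ()
  fuel-suffices zero    (suc a) m       ()
  fuel-suffices (suc f) a       m       a+m≤ none =
    let (fits , rest) = to (carry-step f a m) none
    in from noCarry-step (fits , fuel-suffices f (a / p) (m / p) (halving a m f a+m≤) rest)

  τ≡0⇔noCarry : ∀ {a m} → τ p a m ≡ 0 ⇔ NoCarry a m
  τ≡0⇔noCarry {a} {m} = mk⇔
    (fuel-suffices (a + m + 1) a m (m≤m+n (a + m) 1))
    (λ none → none (a + m + 1))

  mod-shift : ∀ x q → (x + p * q) % p ≡ x % p
  mod-shift x q = trans (cong (λ t → (x + t) % p) (*-comm p q)) ([m+kn]%n≡m%n x q p)

  div-shift : ∀ x q → (x + p * q) / p ≡ x / p + q
  div-shift x q = trans (+-distrib-/-∣ʳ x (m∣m*n q))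
    (cong (_+_ (x / p)) (trans (cong (_/ p) (*-comm p q)) (m*n/n≡m q p)))

  -- Splitting both summands at digit position β: no carry occurs iff none occurs
  -- in the low β digits and none in the high digits (the low part cannot carry out).
  noCarry-split : ∀ β {x u} y v → x < p ^ β → u < p ^ β →
    NoCarry (x + p ^ β * y) (u + p ^ β * v) ⇔ (NoCarry x u × NoCarry y v)
  noCarry-split zero {zero} {zero} y v _ _ = begin
    NoCarry (1 * y) (1 * v) ≡⟨ cong₂ NoCarry (*-identityˡ y) (*-identityˡ v) ⟩
    NoCarry y v ∼⟨ mk⇔ (noCarry-zeroʳ 0 ,_) proj₂ ⟩
    (NoCarry 0 0 × NoCarry y v) ∎
  noCarry-split zero {suc x} y v (s≤s ()) _
  noCarry-split zero {zero} {suc u} y v _ (s≤s ())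
  noCarry-split (suc β) {x} {u} y v x< u< = begin
    NoCarry (x + p * q * y) (u + p * q * v)
      ≡⟨ cong₂ NoCarry (cong (_+_ x) (*-assoc p q y)) (cong (_+_ u) (*-assoc p q v)) ⟩
    NoCarry (x + p * (q * y)) (u + p * (q * v))
      ∼⟨ noCarry-step ⟩
    (DigitsFit (x + p * (q * y)) (u + p * (q * v)) × NoCarry ((x + p * (q * y)) / p) ((u + p * (q * v)) / p))
      ≡⟨ cong₂ _×_ (cong₂ (λ r s → r + s < p) (mod-shift x (q * y)) (mod-shift u (q * v)))
                   (cong₂ NoCarry (div-shift x (q * y)) (div-shift u (q * v))) ⟩
    (DigitsFit x u × NoCarry (x / p + q * y) (u / p + q * v))
      ∼⟨ ⇔.refl ×-⇔ noCarry-split β y v (high x<) (high u<) ⟩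
    (DigitsFit x u × (NoCarry (x / p) (u / p) × NoCarry y v))
      ↔⟨ ×-assoc _ _ _ _ ⟨
    ((DigitsFit x u × NoCarry (x / p) (u / p)) × NoCarry y v)
      ∼⟨ ⇔.sym noCarry-step ×-⇔ ⇔.refl ⟩
    (NoCarry x u × NoCarry y v) ∎
    where
    q : ℕ
    q = p ^ β
    high : ∀ {z} → z < p * q → z / p < q
    high {z} z< = m<n*o⇒m/o<n (subst (z <_) (*-comm p q) z<)

  p∸1<p : p ∸ 1 < p
  p∸1<p = ∸-monoʳ-< {p} {1} {0} z<s (<⇒≤ 1<p)

  fits-top-digit : ∀ r → (r + (p ∸ 1) < p) ⇔ r ≡ 0
  fits-top-digit r = mk⇔
    (λ r+top<p → n<1⇒n≡0 (+-cancelʳ-< (p ∸ 1) r 1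
                   (subst (r + (p ∸ 1) <_) (sym (m+[n∸m]≡n (<⇒≤ 1<p))) r+top<p)))
    (λ { refl → p∸1<p })

  zero-digits : ∀ {y} → (y % p ≡ 0 × y / p ≡ 0) ⇔ y ≡ 0
  zero-digits {y} = mk⇔
    (λ (low , high) → trans (m≡m%n+[m/n]*n y p) (cong₂ (λ r s → r + s * p) low high))
    (λ { refl → 0%p , 0/p })

  borrow : ∀ q → 0 < q → p * q ∸ 1 ≡ (p ∸ 1) + p * (q ∸ 1)
  borrow (suc t) _ = trans (cong (_∸ 1) (*-suc p t)) (+-∸-comm (p * t) (>-nonZero⁻¹ p))

  -- The number p^γ − 1 has all γ digits equal to p − 1, so among numbers below
  -- p^γ only 0 can be added to it without a carry.
  noCarry-allOnes : ∀ γ {y} → y < p ^ γ → NoCarry y (p ^ γ ∸ 1) ⇔ y ≡ 0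
  noCarry-allOnes zero {zero} _ = mk⇔ (λ _ → refl) (λ _ → noCarry-zeroʳ 0)
  noCarry-allOnes zero {suc y} (s≤s ())
  noCarry-allOnes (suc γ) {y} y< = begin
    NoCarry y (p * q ∸ 1)
      ≡⟨ cong (NoCarry y) (borrow q (m^n>0 p γ)) ⟩
    NoCarry y (p ∸ 1 + p * (q ∸ 1))
      ∼⟨ noCarry-step ⟩
    (DigitsFit y (p ∸ 1 + p * (q ∸ 1)) × NoCarry (y / p) ((p ∸ 1 + p * (q ∸ 1)) / p))
      ≡⟨ cong₂ _×_ (cong (λ r → y % p + r < p) low-digit) (cong (NoCarry (y / p)) high-digits) ⟩
    (y % p + (p ∸ 1) < p × NoCarry (y / p) (q ∸ 1))
      ∼⟨ fits-top-digit (y % p) ×-⇔ noCarry-allOnes γ (m<n*o⇒m/o<n (subst (y <_) (*-comm p q) y<)) ⟩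
    (y % p ≡ 0 × y / p ≡ 0)
      ∼⟨ zero-digits ⟩
    y ≡ 0 ∎
    where
    q : ℕ
    q = p ^ γ
    low-digit : (p ∸ 1 + p * (q ∸ 1)) % p ≡ p ∸ 1
    low-digit = trans (mod-shift (p ∸ 1) (q ∸ 1)) (m<n⇒m%n≡m p∸1<p)
    high-digits : (p ∸ 1 + p * (q ∸ 1)) / p ≡ q ∸ 1
    high-digits = trans (div-shift (p ∸ 1) (q ∸ 1)) (cong (_+ (q ∸ 1)) (m<n⇒m/n≡0 p∸1<p))

  -- For α ≤ β the number p^β − p^α has α zero digits followed by β − α digits
  -- p − 1; hence below p^β exactly the numbers below p^α add to it without carry.
  noCarry-block : ∀ {α β} → α ≤ β → ∀ {x} → x < p ^ β → NoCarry x (p ^ β ∸ p ^ α) ⇔ x < p ^ α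
  noCarry-block {α} {β} α≤β {x} x< = begin
    NoCarry x (p ^ β ∸ P)
      ≡⟨ cong₂ NoCarry x-split M-split ⟩
    NoCarry (x % P + P * (x / P)) (0 + P * (p ^ γ ∸ 1))
      ∼⟨ noCarry-split α (x / P) (p ^ γ ∸ 1) (m%n<n x P) (m^n>0 p α) ⟩
    (NoCarry (x % P) 0 × NoCarry (x / P) (p ^ γ ∸ 1))
      ∼⟨ mk⇔ proj₂ (noCarry-zeroʳ (x % P) ,_) ⟩
    NoCarry (x / P) (p ^ γ ∸ 1)
      ∼⟨ noCarry-allOnes γ (m<n*o⇒m/o<n (subst (x <_) (trans factor (*-comm P (p ^ γ))) x<)) ⟩
    x / P ≡ 0
      ∼⟨ mk⇔ m/n≡0⇒m<n m<n⇒m/n≡0 ⟩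
    x < P ∎
    where
    P γ : ℕ
    P = p ^ α
    γ = β ∸ α
    instance
      P≢0 : NonZero P
      P≢0 = m^n≢0 p α
    factor : p ^ β ≡ P * p ^ γ
    factor = trans (cong (p ^_) (sym (m+[n∸m]≡n α≤β))) (^-distribˡ-+-* p α γ)
    x-split : x ≡ x % P + P * (x / P)
    x-split = trans (m≡m%n+[m/n]*n x P) (cong (_+_ (x % P)) (*-comm (x / P) P))
    M-split : p ^ β ∸ P ≡ P * (p ^ γ ∸ 1)
    M-split = trans (cong₂ _∸_ factor (sym (*-identityʳ P))) (sym (*-distribˡ-∸ P (p ^ γ) 1))

fromDigits : ℕ → (ℕ → ℕ) → ℕ → ℕ
fromDigits B w zero    = 0
fromDigits B w (suc L) = w 0 + B * fromDigits B (λ j → w (suc j)) L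

point : ℕ → ℕ → ℕ → ℕ
point zero    a zero    = a
point zero    a (suc j) = 0
point (suc m) a zero    = 0
point (suc m) a (suc j) = point m a j

point-at : ∀ m a → point m a m ≡ a
point-at zero    a = refl
point-at (suc m) a = point-at m a

point-off : ∀ {m j} a → m ≢ j → point m a j ≡ 0
point-off {zero}  {zero}  a m≢j = ⊥-elim (m≢j refl)
point-off {zero}  {suc j} a m≢j = refl
point-off {suc m} {zero}  a m≢j = refl
point-off {suc m} {suc j} a m≢j = point-off a (m≢j ∘ cong suc)

module _ {B : ℕ} where

  fromDigits-cong : ∀ L {w w′} → (∀ j → j < L → w j ≡ w′ j) → fromDigits B w L ≡ fromDigits B w′ L
  fromDigits-cong zero    eq = refl
  fromDigits-cong (suc L) eq =
    cong₂ (λ d r → d + B * r) (eq 0 z<s) (fromDigits-cong L (λ j j<L → eq (suc j) (s≤s j<L)))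

  fromDigits-zero : ∀ L → fromDigits B (λ _ → 0) L ≡ 0
  fromDigits-zero zero    = refl
  fromDigits-zero (suc L) = trans (cong (B *_) (fromDigits-zero L)) (*-zeroʳ B)

  fromDigits-< : ∀ L {w} → (∀ j → j < L → w j < B) → fromDigits B w L < B ^ L
  fromDigits-< zero    _  = z<s
  fromDigits-< (suc L) {w} w< = begin-strict
    w 0 + B * r   <⟨ +-monoˡ-< (B * r) (w< 0 z<s) ⟩
    B + B * r     ≡⟨ *-suc B r ⟨
    B * suc r     ≤⟨ *-monoʳ-≤ B (fromDigits-< L (λ j j<L → w< (suc j) (s≤s j<L))) ⟩
    B * B ^ L     ∎
    where
    open ≤-Reasoning
    r : ℕ
    r = fromDigits B (λ j → w (suc j)) L

  fromDigits-top : ∀ L w → fromDigits B w (suc L) ≡ fromDigits B w L + w L * B ^ L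
  fromDigits-top zero    w = trans (cong (_+_ (w 0)) (*-zeroʳ B)) (trans (+-identityʳ (w 0)) (sym (*-identityʳ (w 0))))
  fromDigits-top (suc L) w = begin
    w 0 + B * fromDigits B w′ (suc L)
      ≡⟨ cong (λ r → w 0 + B * r) (fromDigits-top L w′) ⟩
    w 0 + B * (fromDigits B w′ L + w′ L * B ^ L)
      ≡⟨ cong (_+_ (w 0)) (*-distribˡ-+ B _ _) ⟩
    w 0 + (B * fromDigits B w′ L + B * (w′ L * B ^ L))
      ≡⟨ +-assoc (w 0) _ _ ⟨
    w 0 + B * fromDigits B w′ L + B * (w′ L * B ^ L)
      ≡⟨ cong (_+_ (w 0 + B * fromDigits B w′ L)) (x∙yz≈y∙xz B (w′ L) (B ^ L)) ⟩
    w 0 + B * fromDigits B w′ L + w′ L * (B * B ^ L) ∎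
    where
    open ≡-Reasoning
    w′ : ℕ → ℕ
    w′ j = w (suc j)

  fromDigits-<-top : ∀ L {w t} → (∀ j → j < L → w j < B) → w L < t → fromDigits B w (suc L) < t * B ^ L
  fromDigits-<-top L {w} {t} w< top< = begin-strict
    fromDigits B w (suc L)        ≡⟨ fromDigits-top L w ⟩
    fromDigits B w L + w L * B ^ L <⟨ +-monoˡ-< (w L * B ^ L) (fromDigits-< L w<) ⟩
    suc (w L) * B ^ L              ≤⟨ *-monoˡ-≤ (B ^ L) top< ⟩
    t * B ^ L                      ∎
    where open ≤-Reasoning

  sum-applyUpTo-scale : ∀ L (f g : ℕ → ℕ) → (∀ j → f j ≡ B * g j) →
    List.sum (applyUpTo f L) ≡ B * List.sum (applyUpTo g L)
  sum-applyUpTo-scale zero    f g eq = sym (*-zeroʳ B)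
  sum-applyUpTo-scale (suc L) f g eq =
    trans (cong₂ _+_ (eq 0) (sum-applyUpTo-scale L (λ j → f (suc j)) (λ j → g (suc j)) (λ j → eq (suc j))))
          (sym (*-distribˡ-+ B (g 0) _))

  sum-digits≡fromDigits : ∀ L w → List.sum (applyUpTo (λ j → w j * B ^ j) L) ≡ fromDigits B w L
  sum-digits≡fromDigits zero    w = refl
  sum-digits≡fromDigits (suc L) w = cong₂ _+_ (*-identityʳ (w 0)) (begin
    List.sum (applyUpTo (λ j → w (suc j) * (B * B ^ j)) L)
      ≡⟨ sum-applyUpTo-scale L _ (λ j → w (suc j) * B ^ j) (λ j → x∙yz≈y∙xz (w (suc j)) B (B ^ j)) ⟩
    B * List.sum (applyUpTo (λ j → w (suc j) * B ^ j) L)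
      ≡⟨ cong (B *_) (sum-digits≡fromDigits L (λ j → w (suc j))) ⟩
    B * fromDigits B (λ j → w (suc j)) L ∎)
    where open ≡-Reasoning

  fromDigits-point : ∀ L {m} a → m < L → fromDigits B (point m a) L ≡ a * B ^ m
  fromDigits-point (suc L) {zero}  a _ = begin
    a + B * fromDigits B (λ _ → 0) L ≡⟨ cong (λ r → a + B * r) (fromDigits-zero L) ⟩
    a + B * 0                        ≡⟨ cong (_+_ a) (*-zeroʳ B) ⟩
    a + 0                            ≡⟨ +-identityʳ a ⟩
    a                                ≡⟨ *-identityʳ a ⟨
    a * 1                            ∎
    where open ≡-Reasoning
  fromDigits-point (suc L) {suc m} a (s≤s m<L) =
    trans (cong (B *_) (fromDigits-point L a m<L)) (x∙yz≈y∙xz B a (B ^ m))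

  fromDigits-∑ : ∀ L {K} (f : Fin K → ℕ → ℕ) →
    fromDigits B (λ j → ∑[ i < K ] f i j) L ≡ ∑[ i < K ] fromDigits B (f i) L
  fromDigits-∑ zero {K} f = sym (sum-replicate-zero K)
  fromDigits-∑ (suc L) {K} f = begin
    ∑[ i < K ] f i 0 + B * fromDigits B (λ j → ∑[ i < K ] f i (suc j)) L
      ≡⟨ cong (λ r → ∑[ i < K ] f i 0 + B * r) (fromDigits-∑ L (λ i j → f i (suc j))) ⟩
    ∑[ i < K ] f i 0 + B * ∑[ i < K ] fromDigits B (λ j → f i (suc j)) L
      ≡⟨ cong (λ r → ∑[ i < K ] f i 0 + r) (*-distribˡ-sum B (λ i → fromDigits B (λ j → f i (suc j)) L)) ⟩
    ∑[ i < K ] f i 0 + ∑[ i < K ] (B * fromDigits B (λ j → f i (suc j)) L)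
      ≡⟨ ∑-distrib-+ (λ i → f i 0) _ ⟨
    ∑[ i < K ] fromDigits B (f i) (suc L) ∎
    where open ≡-Reasoning

ΣFin≡∑ : ∀ K (f : Fin K → ℕ) → ΣFin K f ≡ ∑[ i < K ] f i
ΣFin≡∑ zero    f = refl
ΣFin≡∑ (suc K) f = cong (_+_ (f zero)) (ΣFin≡∑ K (f ∘ suc))

∑-single : ∀ {K} (g : Fin (suc K) → ℕ) i → (∀ i′ → i′ ≢ i → g i′ ≡ 0) → sum g ≡ g i
∑-single {K} g i others-vanish = begin
  sum g                                  ≡⟨ sum-remove {i = i} g ⟩
  g i + ∑[ j < K ] g (punchIn i j)        ≡⟨ cong (_+_ (g i)) (sum-cong-≗ λ j →
                                               others-vanish (punchIn i j) (punchInᵢ≢i i j)) ⟩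
  g i + ∑[ j < K ] 0                      ≡⟨ cong (_+_ (g i)) (sum-replicate-zero K) ⟩
  g i + 0                                ≡⟨ +-identityʳ (g i) ⟩
  g i                                    ∎
  where open ≡-Reasoning

-- scatter n z: the digit sequence carrying z i at position n i (summing
-- collisions); for distinct positions it is the base-B expansion of Σ_i z_i B^{n_i}.
scatter : ∀ {K} → (Fin K → ℕ) → (Fin K → ℕ) → ℕ → ℕ
scatter {K} n z j = ∑[ i < K ] point (n i) (z i) j

fromDigits-scatter : ∀ {B} L {K} (n z : Fin K → ℕ) → (∀ i → n i < L) →
  fromDigits B (scatter n z) L ≡ ∑[ i < K ] (z i * B ^ n i)
fromDigits-scatter L n z n< =
  trans (fromDigits-∑ L (λ i → point (n i) (z i))) (sum-cong-≗ λ i → fromDigits-point L (z i) (n< i))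

scatter-at : ∀ {K} {n : Fin (suc K) → ℕ} → Injective _≡_ _≡_ n → ∀ z i → scatter n z (n i) ≡ z i
scatter-at {n = n} n-inj z i =
  trans (∑-single (λ i′ → point (n i′) (z i′) (n i)) i (λ i′ i′≢i → point-off (z i′) (i′≢i ∘ n-inj)))
        (point-at (n i) (z i))

scatter-off : ∀ {K} {n : Fin K → ℕ} {j} → (∀ i → n i ≢ j) → ∀ z → scatter n z j ≡ 0
scatter-off {K} off z = trans (sum-cong-≗ λ i → point-off (z i) (off i)) (sum-replicate-zero K)

module CarryFreeDigits (p : ℕ) .{{_ : NonZero p}} (1<p : 1 < p) (β : ℕ) where

  open NoCarries p 1<p
  open Equivalence using (to; from)

  B : ℕ
  B = p ^ β

  instance
    B≢0 : NonZero B
    B≢0 = m^n≢0 p β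

  record CarryFreeBelow (m t : ℕ) : Set where
    field
      digit<  : m < B
      bound≤  : t ≤ B
      partner : ∀ {x} → x < B → NoCarry x m ⇔ x < t

  open CarryFreeBelow

  noCarry-digits⇒ : ∀ L {d t : ℕ → ℕ} → (∀ j → CarryFreeBelow (d j) (t j)) →
    ∀ {c} → c < B ^ L → NoCarry c (fromDigits B d L) →
    Σ (ℕ → ℕ) λ w → (∀ j → j < L → w j < t j) × c ≡ fromDigits B w L
  noCarry-digits⇒ zero    _ c<1 _ = (λ _ → 0) , (λ _ ()) , n<1⇒n≡0 c<1
  noCarry-digits⇒ (suc L) {d} {t} digits {c} c< none =
    let (low , high) = to (noCarry-split β (c / B) (fromDigits B (λ j → d (suc j)) L) (m%n<n c B) (digit< (digits 0)))
                          (subst (λ x → NoCarry x _) c-split none)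
        (w , w<t , c/B≡) = noCarry-digits⇒ L (λ j → digits (suc j))
                             (m<n*o⇒m/o<n (subst (c <_) (*-comm B (B ^ L)) c<)) high
    in cons (c % B) w ,
       (λ { zero _ → to (partner (digits 0) (m%n<n c B)) low ; (suc j) j<L → w<t j (s≤s⁻¹ j<L) }) ,
       trans c-split (cong (λ r → c % B + B * r) c/B≡)
    where
    c-split : c ≡ c % B + B * (c / B)
    c-split = trans (m≡m%n+[m/n]*n c B) (cong (_+_ (c % B)) (*-comm (c / B) B))
    cons : ℕ → (ℕ → ℕ) → ℕ → ℕ
    cons a w zero    = a
    cons a w (suc j) = w j

  noCarry-digits⇐ : ∀ L {d t : ℕ → ℕ} → (∀ j → CarryFreeBelow (d j) (t j)) →
    ∀ w → (∀ j → j < L → w j < t j) → NoCarry (fromDigits B w L) (fromDigits B d L)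
  noCarry-digits⇐ zero    _      w _   = noCarry-zeroʳ 0
  noCarry-digits⇐ (suc L) digits w w<t =
    from (noCarry-split β _ _ (≤-trans (w<t 0 z<s) (bound≤ (digits 0))) (digit< (digits 0)))
      ( from (partner (digits 0) (≤-trans (w<t 0 z<s) (bound≤ (digits 0)))) (w<t 0 z<s)
      , noCarry-digits⇐ L (λ j → digits (suc j)) (λ j → w (suc j)) (λ j j<L → w<t (suc j) (s≤s j<L)))

  block-digit : ∀ {γ} → γ ≤ β → CarryFreeBelow (B ∸ p ^ γ) (p ^ γ)
  block-digit {γ} γ≤β = record
    { digit<  = ∸-monoʳ-< {B} {p ^ γ} {0} (m^n>0 p γ) (^-monoʳ-≤ p γ≤β)
    ; bound≤  = ^-monoʳ-≤ p γ≤β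
    ; partner = noCarry-block γ≤β
    }

module SparseRepresentation (p : ℕ) .{{_ : NonZero p}} (1<p : 1 < p) {α β : ℕ} (α≤β : α ≤ β)
  (k : ℕ) (n : Fin (suc k) → ℕ) (n-mono : ∀ i j → i Fin.< j → n i < n j) where

  open NoCarries p 1<p
  open CarryFreeDigits p 1<p β

  b N M : ℕ
  b = p ^ α
  N = n (fromℕ k)
  M = Mnum B b n N

  -- The allowed digits of a representable number: below b at the positions n_i,
  -- only 0 elsewhere.
  bound : ℕ → ℕ
  bound j = if ⌊ any? (λ i → n i ≟ j) ⌋ then b else 1

  -- The base-B digits of M are B − b at the positions n_i and B − 1 = B − p^0
  -- elsewhere, so their carry-free partners are exactly the allowed digits.
  M-digits : ∀ j → CarryFreeBelow (digitM B b n j) (bound j)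
  M-digits j with any? (λ i → n i ≟ j)
  ... | yes _ = block-digit α≤β
  ... | no  _ = block-digit z≤n

  n-injective : Injective _≡_ _≡_ n
  n-injective {i} {i′} eq with Finₚ.<-cmp i i′
  ... | tri< i<i′ _ _ = ⊥-elim (<⇒≢ (n-mono i i′ i<i′) eq)
  ... | tri≈ _ i≡i′ _ = i≡i′
  ... | tri> _ _ i′<i = ⊥-elim (<⇒≢ (n-mono i′ i i′<i) (sym eq))

  n≤N : ∀ i → n i ≤ N
  n≤N i with m≤n⇒m<n∨m≡n (subst (Fin.toℕ i ≤_) (toℕ-fromℕ k) (≤fromℕ i))
  ... | inj₁ i<k = <⇒≤ (n-mono i (fromℕ k) (subst (Fin.toℕ i <_) (sym (toℕ-fromℕ k)) i<k))
  ... | inj₂ i≡k = ≤-reflexive (cong n (toℕ-injective (trans i≡k (sym (toℕ-fromℕ k)))))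

  bound-at : ∀ i → bound (n i) ≡ b
  bound-at i with any? (λ i′ → n i′ ≟ n i)
  ... | yes _   = refl
  ... | no  off = ⊥-elim (off (i , refl))

  bounded⇒scatter : ∀ w j → w j < bound j → w j ≡ scatter n (w ∘ n) j
  bounded⇒scatter w j w< with any? (λ i → n i ≟ j)
  ... | yes (i , refl) = sym (scatter-at n-injective (w ∘ n) i)
  ... | no  off        = trans (n<1⇒n≡0 w<) (sym (scatter-off (λ i eq → off (i , eq)) (w ∘ n)))

  scatter-bounded : ∀ z → (∀ i → z i < b) → ∀ j → scatter n z j < bound j
  scatter-bounded z z< j with any? (λ i → n i ≟ j)
  ... | yes (i , refl) = subst (_< b) (sym (scatter-at n-injective z i)) (z< i)
  ... | no  off        = subst (_< 1) (sym (scatter-off (λ i eq → off (i , eq)) z)) z<s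

  M≡fromDigits : M ≡ fromDigits B (digitM B b n) (suc N)
  M≡fromDigits = trans (cong List.sum (map-upTo _ (suc N)))
                       (sum-digits≡fromDigits {B = B} (suc N) (digitM B b n))

  sparse : (Fin (suc k) → ℕ) → ℕ
  sparse z = ΣFin (suc k) (λ i → z i * B ^ n i)

  sparse≡fromDigits : ∀ z → sparse z ≡ fromDigits B (scatter n z) (suc N)
  sparse≡fromDigits z = trans (ΣFin≡∑ (suc k) (λ i → z i * B ^ n i))
                              (sym (fromDigits-scatter {B = B} (suc N) n z (λ i → s≤s (n≤N i))))

  sparse<b*B^N : ∀ z → (∀ i → z i < b) → sparse z < b * B ^ N
  sparse<b*B^N z z< = subst (_< b * B ^ N) (sym (sparse≡fromDigits z))
    (fromDigits-<-top N (λ j _ → ≤-trans (scatter-bounded z z< j) (CarryFreeBelow.bound≤ (M-digits j)))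
                        (subst (scatter n z N <_) (bound-at (fromℕ k)) (scatter-bounded z z< N)))

  sparse-noCarry : ∀ z → (∀ i → z i < b) → NoCarry (sparse z) M
  sparse-noCarry z z< = subst₂ NoCarry (sym (sparse≡fromDigits z)) (sym M≡fromDigits)
    (noCarry-digits⇐ (suc N) M-digits (scatter n z) (λ j _ → scatter-bounded z z< j))

  noCarry⇒sparse : ∀ {x} → x < B ^ suc N → NoCarry x M →
    Σ (Fin (suc k) → ℕ) λ z → (∀ i → z i < b) × x ≡ sparse z
  noCarry⇒sparse {x} x< none =
    let (w , w<bound , x≡w) = noCarry-digits⇒ (suc N) M-digits x< (subst (NoCarry x) M≡fromDigits none)
    in w ∘ n ,
       (λ i → subst (w (n i) <_) (bound-at i) (w<bound (n i) (s≤s (n≤N i)))) ,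
       trans x≡w (trans (fromDigits-cong {B = B} (suc N) (λ j j≤N → bounded⇒scatter w j (w<bound j j≤N)))
                        (sym (sparse≡fromDigits (w ∘ n))))

lemma2p3 : (p : ℕ) → .{{_ : NonZero p}} → 1 < p →
    (b B : ℕ) → b ∈↑ p → B ∈↑ p → b ≤ B →
    (k : ℕ) → (n : Fin (suc k) → ℕ) → (∀ i j → i Fin.< j → n i < n j) →
    (C : ℕ) → 0 < C →
    b * B ^ n (fromℕ k) ≤ C → C ≤ B * B ^ n (fromℕ k) →
    (c : ℤ) →
      (Σ (Fin (suc k) → ℕ) (λ z → ((i : Fin (suc k)) → z i < b)
          × c ≡ + ΣFin (suc k) (λ i → z i * B ^ n i)))
      ⇔ ((ℤ.+ 0 ℤ.≤ c × c ℤ.< + C)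
          × τ p ∣ c ∣ (Mnum B b n (n (fromℕ k))) ≡ 0)
lemma2p3 p 1<p .(p ^ α) .(p ^ β) (α , refl) (β , refl) b≤B k n n-mono C _ b*B^N≤C C≤B*B^N (+ x) =
  mk⇔ (λ { (z , z<b , refl) →
           (ℤ.+≤+ z≤n , ℤ.+<+ (<-≤-trans (sparse<b*B^N z z<b) b*B^N≤C)) ,
           Equivalence.from τ≡0⇔noCarry (sparse-noCarry z z<b) })
      (λ { ((_ , ℤ.+<+ x<C) , τ≡0) →
           let (z , z<b , x≡) = noCarry⇒sparse (<-≤-trans x<C C≤B*B^N) (Equivalence.to τ≡0⇔noCarry τ≡0)
           in z , z<b , cong +_ x≡ })
  where
  α≤β : α ≤ β
  α≤β = ≮⇒≥ (λ β<α → <⇒≱ (^-monoʳ-< p 1<p β<α) b≤B)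
  open SparseRepresentation p 1<p α≤β k n n-mono
  open NoCarries p 1<p using (τ≡0⇔noCarry)
lemma2p3 p 1<p b B _ _ _ k n _ C _ _ _ -[1+ x ] = mk⇔ (λ { (_ , _ , ()) }) (λ { ((() , _) , _) })
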